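{- Let $v_1=(x_1,y_1)$, $v_2=(x_2,y_2)$, $v_3=(x_3,y_3)$ be distinct points of $A_2$. Let $x_{\rm mid}$ denote the middle value among $x_1,x_2,x_3$ (i.e., if $x'_1\le x'_2\le x'_3$ is their nondecreasing rearrangement then $x_{\rm mid}=x'_2$), and define $y_{\rm mid}$ similarly. Then the tristance of $v_1,v_2,v_3$ in the hexagonal graph is $$\sum_{i=1}^3\Bigl(\max\{x_i-x_{\rm mid},\,y_i-y_{\rm mid},\,0\}-\min\{x_i-x_{\rm mid},\,y_i-y_{\rm mid},\,0\}\Bigr).$$
   Context: Let $\omega=-\tfrac12+\tfrac{\sqrt3}{2}i$. The hexagonal lattice is $A_2=\{x+\omega y: x,y\in\mathbb{Z}\}$, and the point $x+\omega y$ is written $(x,y)$. The hexagonal graph has vertex set $A_2$, two points being adjacent iff their Euclidean distance (in $\mathbb{C}$) is $1$; equivalently $(x,y)$ is adjacent to $(x\pm1,y)$, $(x,y\pm1)$, $(x+1,y+1)$, $(x-1,y-1)$. The tristance of three points is the minimum number of edges of a tree in the hexagonal graph (possibly using additional vertices) containing them. -}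

module Defs where

open import Data.Nat using (ℕ; suc; _≤_)
open import Data.Integer using (ℤ; +_; -[1+_]; _+_; _-_; _⊔_; _⊓_)
open import Data.Product using (_×_; _,_; Σ; swap)
open import Data.Sum using (_⊎_)
open import Data.List using (List; length)
open import Data.List.Membership.Propositional using (_∈_)
open import Data.List.Relation.Unary.All using (All)
open import Data.List.Relation.Unary.AllPairs using (AllPairs)
open import Data.List.Relation.Unary.Unique.Propositional using (Unique)
open import Relation.Binary.PropositionalEquality using (_≡_)
open import Relation.Nullary using (¬_)

-- A point (x , y) of A₂ stands for x + ω y.
Point : Set
Point = ℤ × ℤ

-- Adjacency in the hexagonal graph (Euclidean distance 1):
-- (x,y) ~ (x±1,y), (x,y±1), (x+1,y+1), (x-1,y-1).
data Adj : Point → Point → Set where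
  e+x  : ∀ x y → Adj (x , y) (x + + 1 , y)
  e-x  : ∀ x y → Adj (x , y) (x - + 1 , y)
  e+y  : ∀ x y → Adj (x , y) (x , y + + 1)
  e-y  : ∀ x y → Adj (x , y) (x , y - + 1)
  e+xy : ∀ x y → Adj (x , y) (x + + 1 , y + + 1)
  e-xy : ∀ x y → Adj (x , y) (x - + 1 , y - + 1)

Edge : Set
Edge = Point × Point

SameEdge : Edge → Edge → Set
SameEdge e f = (e ≡ f) ⊎ (e ≡ swap f)

data Walk (E : List Edge) : Point → Point → Set where
  here : ∀ {u} → Walk E u u
  step : ∀ {u w v} → ((u , w) ∈ E ⊎ (w , u) ∈ E) → Walk E w v → Walk E u v

record IsTree (V : List Point) (E : List Edge) : Set where
  field
    vertsUnique : Unique V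
    edgesUnique : AllPairs (λ e f → ¬ SameEdge e f) E
    edgesAdj    : All (λ e → Adj (Data.Product.proj₁ e) (Data.Product.proj₂ e)) E
    edgesInV    : All (λ e → (Data.Product.proj₁ e ∈ V) × (Data.Product.proj₂ e ∈ V)) E
    connected   : ∀ {u v} → u ∈ V → v ∈ V → Walk E u v
    edgeCount   : suc (length E) ≡ length V

record TreeContaining (p q r : Point) : Set where
  field
    verts  : List Point
    edges  : List Edge
    isTree : IsTree verts edges
    p∈     : p ∈ verts
    q∈     : q ∈ verts
    r∈     : r ∈ verts

size : ∀ {p q r} → TreeContaining p q r → ℕ
size t = length (TreeContaining.edges t)

IsTristance : Point → Point → Point → ℕ → Set
IsTristance p q r d =
  Σ (TreeContaining p q r) (λ t → size t ≡ d) ×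
  (∀ (t : TreeContaining p q r) → d ≤ size t)

-- Middle value of three integers (the second entry of their sorted list).
mid : ℤ → ℤ → ℤ → ℤ
mid a b c = (a ⊓ b) ⊔ ((a ⊔ b) ⊓ c)

spread : ℤ → ℤ → ℤ
spread a b = (a ⊔ b ⊔ + 0) - (a ⊓ b ⊓ + 0)

formula : Point → Point → Point → ℤ
formula (x₁ , y₁) (x₂ , y₂) (x₃ , y₃) =
  spread (x₁ - xm) (y₁ - ym) + spread (x₂ - xm) (y₂ - ym) + spread (x₃ - xm) (y₃ - ym)
  where
  xm = mid x₁ x₂ x₃
  ym = mid y₁ y₂ y₃

-- Write twiceDist u v = |Δx| + |Δy| + |Δx − Δy|, twice the graph distance between u and v.
-- Lower bound: in a tree containing v₁, v₂, v₃, let c be the first vertex of the path from v₃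
-- to v₁ that lies on the path from v₁ to v₂; the three paths from the vᵢ to c meet only at c,
-- so the tree has at least half of Σ twiceDist vᵢ c edges. In the coordinates x, y and x − y
-- this sum is a sum of absolute deviations, minimised at the coordinatewise median
-- m = (x_mid, y_mid): the medians minimise the x- and y-parts with a gain that pays for the
-- x − y part, because x_mid − y_mid lies between the smallest and largest xᵢ − yᵢ.
-- Upper bound: from m, walk toward each vᵢ in steps that lower twiceDist by 2; this grows a
-- tree with half of Σ twiceDist vᵢ m edges. Finally 2 (max{a,b,0} − min{a,b,0}) =
-- |a| + |b| + |a − b| identifies the formula with that half.

module Submission where

open import Defs
open import Data.Nat using (ℕ)
open import Data.Integer using (+_)
open import Data.Product using (Σ; _×_)
open import Relation.Binary.PropositionalEquality using (_≡_; _≢_)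

module Medians where

  open import Data.Integer as ℤ using (ℤ; +_; 0ℤ; _+_; _-_; -_; _⊔_; _⊓_; _≤_; ∣_∣; +≤+; -≤+)
  open import Data.Integer.Properties
  open import Data.Integer.Tactic.RingSolver
  open import Data.List using ([]; _∷_)
  open import Data.Product using (Σ; _×_; _,_)
  open import Data.Sum using (inj₁; inj₂)
  open import Relation.Binary.PropositionalEquality

  abs : ℤ → ℤ
  abs i = + ∣ i ∣

  abs-nonpos : ∀ {i} → i ≤ 0ℤ → abs i ≡ - i
  abs-nonpos {i} i≤0 = trans (sym (cong +_ (∣-i∣≡∣i∣ i))) (0≤i⇒+∣i∣≡i (neg-mono-≤ i≤0))

  abs-sym : ∀ i j → abs (i - j) ≡ abs (j - i)
  abs-sym i j = cong +_ (∣i-j∣≡∣j-i∣ i j)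

  abs-≥ : ∀ {i j} → j ≤ i → abs (i - j) ≡ i - j
  abs-≥ {i} {j} j≤i = trans (abs-sym i j) (∣-∣-≤ j≤i)

  i≤abs : ∀ i → i ≤ abs i
  i≤abs (+ n) = ≤-refl
  i≤abs ℤ.-[1+ n ] = -≤+

  -i≤abs : ∀ i → - i ≤ abs i
  -i≤abs i = subst (- i ≤_) (cong +_ (∣-i∣≡∣i∣ i)) (i≤abs (- i))

  abs-triangle : ∀ i j k → abs (i - k) ≤ abs (i - j) + abs (j - k)
  abs-triangle i j k = subst (λ x → abs x ≤ abs (i - j) + abs (j - k)) (telescope i j k)
    (+≤+ (∣i+j∣≤∣i∣+∣j∣ (i - j) (j - k)))
    where
    telescope : ∀ i j k → (i - j) + (j - k) ≡ i - k
    telescope = solve-∀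

  private
    spread-double-via : ∀ {a b M M′ m m′ p q r} →
      a ⊔ b ≡ M → M ⊔ 0ℤ ≡ M′ → a ⊓ b ≡ m → m ⊓ 0ℤ ≡ m′ →
      abs a ≡ p → abs b ≡ q → abs (a - b) ≡ r → (M′ - m′) + (M′ - m′) ≡ p + q + r →
      spread a b + spread a b ≡ abs a + abs b + abs (a - b)
    spread-double-via refl refl refl refl refl refl refl e = e

  spread-double : ∀ a b → spread a b + spread a b ≡ abs a + abs b + abs (a - b)
  spread-double a b with ≤-total a b | ≤-total b 0ℤ | ≤-total a 0ℤ
  ... | inj₁ a≤b | inj₁ b≤0 | _ = spread-double-via
    (i≤j⇒i⊔j≡j a≤b) (i≤j⇒i⊔j≡j b≤0) (i≤j⇒i⊓j≡i a≤b) (i≤j⇒i⊓j≡i (≤-trans a≤b b≤0))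
    (abs-nonpos (≤-trans a≤b b≤0)) (abs-nonpos b≤0) (∣-∣-≤ a≤b) (solve (a ∷ b ∷ []))
  ... | inj₁ a≤b | inj₂ 0≤b | inj₁ a≤0 = spread-double-via
    (i≤j⇒i⊔j≡j a≤b) (i≥j⇒i⊔j≡i 0≤b) (i≤j⇒i⊓j≡i a≤b) (i≤j⇒i⊓j≡i a≤0)
    (abs-nonpos a≤0) (0≤i⇒+∣i∣≡i 0≤b) (∣-∣-≤ a≤b) (solve (a ∷ b ∷ []))
  ... | inj₁ a≤b | inj₂ 0≤b | inj₂ 0≤a = spread-double-via
    (i≤j⇒i⊔j≡j a≤b) (i≥j⇒i⊔j≡i 0≤b) (i≤j⇒i⊓j≡i a≤b) (i≥j⇒i⊓j≡j 0≤a)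
    (0≤i⇒+∣i∣≡i 0≤a) (0≤i⇒+∣i∣≡i 0≤b) (∣-∣-≤ a≤b) (solve (a ∷ b ∷ []))
  ... | inj₂ b≤a | _ | inj₁ a≤0 = spread-double-via
    (i≥j⇒i⊔j≡i b≤a) (i≤j⇒i⊔j≡j a≤0) (i≥j⇒i⊓j≡j b≤a) (i≤j⇒i⊓j≡i (≤-trans b≤a a≤0))
    (abs-nonpos a≤0) (abs-nonpos (≤-trans b≤a a≤0)) (abs-≥ b≤a) (solve (a ∷ b ∷ []))
  ... | inj₂ b≤a | inj₁ b≤0 | inj₂ 0≤a = spread-double-via
    (i≥j⇒i⊔j≡i b≤a) (i≥j⇒i⊔j≡i 0≤a) (i≥j⇒i⊓j≡j b≤a) (i≤j⇒i⊓j≡i b≤0)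
    (0≤i⇒+∣i∣≡i 0≤a) (abs-nonpos b≤0) (abs-≥ b≤a) (solve (a ∷ b ∷ []))
  ... | inj₂ b≤a | inj₂ 0≤b | inj₂ 0≤a = spread-double-via
    (i≥j⇒i⊔j≡i b≤a) (i≥j⇒i⊔j≡i 0≤a) (i≥j⇒i⊓j≡j b≤a) (i≥j⇒i⊓j≡j 0≤b)
    (0≤i⇒+∣i∣≡i 0≤a) (0≤i⇒+∣i∣≡i 0≤b) (abs-≥ b≤a) (solve (a ∷ b ∷ []))

  data Perm3 {A : Set} (a b c : A) : A → A → A → Set where
    abc : Perm3 a b c a b c
    acb : Perm3 a b c a c b
    bac : Perm3 a b c b a c
    bca : Perm3 a b c b c a
    cab : Perm3 a b c c a b
    cba : Perm3 a b c c b a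

  data AnyOf3 {A : Set} (P : A → Set) (a b c : A) : Set where
    first  : P a → AnyOf3 P a b c
    second : P b → AnyOf3 P a b c
    third  : P c → AnyOf3 P a b c

  data TwoOf3 {A : Set} (P : A → Set) (a b c : A) : Set where
    first-second : P a → P b → TwoOf3 P a b c
    first-third  : P a → P c → TwoOf3 P a b c
    second-third : P b → P c → TwoOf3 P a b c

  AllOf3 : {A : Set} → (A → Set) → A → A → A → Set
  AllOf3 P a b c = P a × P b × P c

  module _ {A : Set} {a b c u m w : A} where

    Perm3-map : {B : Set} (f : A → B) → Perm3 a b c u m w → Perm3 (f a) (f b) (f c) (f u) (f m) (f w)
    Perm3-map f abc = abc
    Perm3-map f acb = acb
    Perm3-map f bac = bac
    Perm3-map f bca = bca
    Perm3-map f cab = cab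
    Perm3-map f cba = cba

    AllOf3-perm : ∀ {P} → Perm3 a b c u m w → AllOf3 P u m w → AllOf3 P a b c
    AllOf3-perm abc (pu , pm , pw) = pu , pm , pw
    AllOf3-perm acb (pu , pm , pw) = pu , pw , pm
    AllOf3-perm bac (pu , pm , pw) = pm , pu , pw
    AllOf3-perm bca (pu , pm , pw) = pw , pu , pm
    AllOf3-perm cab (pu , pm , pw) = pm , pw , pu
    AllOf3-perm cba (pu , pm , pw) = pw , pm , pu

    TwoOf3-perm-upper : ∀ {P} → Perm3 a b c u m w → P m → P w → TwoOf3 P a b c
    TwoOf3-perm-upper abc pm pw = second-third pm pw
    TwoOf3-perm-upper acb pm pw = second-third pw pm
    TwoOf3-perm-upper bac pm pw = first-third pm pw
    TwoOf3-perm-upper bca pm pw = first-third pw pm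
    TwoOf3-perm-upper cab pm pw = first-second pm pw
    TwoOf3-perm-upper cba pm pw = first-second pw pm

    TwoOf3-perm-lower : ∀ {P} → Perm3 a b c u m w → P u → P m → TwoOf3 P a b c
    TwoOf3-perm-lower abc pu pm = first-second pu pm
    TwoOf3-perm-lower acb pu pm = first-third pu pm
    TwoOf3-perm-lower bac pu pm = first-second pm pu
    TwoOf3-perm-lower bca pu pm = second-third pu pm
    TwoOf3-perm-lower cab pu pm = first-third pm pu
    TwoOf3-perm-lower cba pu pm = second-third pm pu

  AnyOf3-AllOf3 : ∀ {A : Set} {P Q : A → Set} {a b c} → AnyOf3 P a b c → AllOf3 Q a b c → Σ A λ x → P x × Q x
  AnyOf3-AllOf3 (first p)  (q , _ , _) = _ , p , q
  AnyOf3-AllOf3 (second p) (_ , q , _) = _ , p , q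
  AnyOf3-AllOf3 (third p)  (_ , _ , q) = _ , p , q

  TwoOf3-overlap : ∀ {A B C : Set} {P : A → Set} {Q : B → Set} {R : C → Set} (f : A → B → C) →
    (∀ {x y} → P x → Q y → R (f x y)) →
    ∀ {a b c a′ b′ c′} → TwoOf3 P a b c → TwoOf3 Q a′ b′ c′ → AnyOf3 R (f a a′) (f b b′) (f c c′)
  TwoOf3-overlap f g (first-second pa pb) (first-second qa qb) = first (g pa qa)
  TwoOf3-overlap f g (first-second pa pb) (first-third qa qc)  = first (g pa qa)
  TwoOf3-overlap f g (first-second pa pb) (second-third qb qc) = second (g pb qb)
  TwoOf3-overlap f g (first-third pa pc)  (first-second qa qb) = first (g pa qa)
  TwoOf3-overlap f g (first-third pa pc)  (first-third qa qc)  = first (g pa qa)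
  TwoOf3-overlap f g (first-third pa pc)  (second-third qb qc) = third (g pc qc)
  TwoOf3-overlap f g (second-third pb pc) (first-second qa qb) = second (g pb qb)
  TwoOf3-overlap f g (second-third pb pc) (first-third qa qc)  = third (g pc qc)
  TwoOf3-overlap f g (second-third pb pc) (second-third qb qc) = second (g pb qb)

  +-perm3 : ∀ {a b c u m w} → Perm3 a b c u m w → a + b + c ≡ u + m + w
  +-perm3 abc = refl
  +-perm3 {a} {b} {c} acb = solve (a ∷ b ∷ c ∷ [])
  +-perm3 {a} {b} {c} bac = solve (a ∷ b ∷ c ∷ [])
  +-perm3 {a} {b} {c} bca = solve (a ∷ b ∷ c ∷ [])
  +-perm3 {a} {b} {c} cab = solve (a ∷ b ∷ c ∷ [])
  +-perm3 {a} {b} {c} cba = solve (a ∷ b ∷ c ∷ [])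

  record Sorted3 (a b c : ℤ) : Set where
    constructor sorted
    field
      {lo md hi} : ℤ
      lo≤md      : lo ≤ md
      md≤hi      : md ≤ hi
      perm       : Perm3 a b c lo md hi
      mid≡md     : mid a b c ≡ md

  private
    mid-via : ∀ {a b c p q r m} → a ⊓ b ≡ p → a ⊔ b ≡ q → q ⊓ c ≡ r → p ⊔ r ≡ m → mid a b c ≡ m
    mid-via refl refl refl e = e

  sort3 : ∀ a b c → Sorted3 a b c
  sort3 a b c with ≤-total a b | ≤-total b c | ≤-total a c
  ... | inj₁ a≤b | inj₁ b≤c | _ = sorted a≤b b≤c abc
    (mid-via (i≤j⇒i⊓j≡i a≤b) (i≤j⇒i⊔j≡j a≤b) (i≤j⇒i⊓j≡i b≤c) (i≤j⇒i⊔j≡j a≤b))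
  ... | inj₁ a≤b | inj₂ c≤b | inj₁ a≤c = sorted a≤c c≤b acb
    (mid-via (i≤j⇒i⊓j≡i a≤b) (i≤j⇒i⊔j≡j a≤b) (i≥j⇒i⊓j≡j c≤b) (i≤j⇒i⊔j≡j a≤c))
  ... | inj₁ a≤b | inj₂ c≤b | inj₂ c≤a = sorted c≤a a≤b cab
    (mid-via (i≤j⇒i⊓j≡i a≤b) (i≤j⇒i⊔j≡j a≤b) (i≥j⇒i⊓j≡j c≤b) (i≥j⇒i⊔j≡i c≤a))
  ... | inj₂ b≤a | inj₁ b≤c | inj₁ a≤c = sorted b≤a a≤c bac
    (mid-via (i≥j⇒i⊓j≡j b≤a) (i≥j⇒i⊔j≡i b≤a) (i≤j⇒i⊓j≡i a≤c) (i≤j⇒i⊔j≡j b≤a))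
  ... | inj₂ b≤a | inj₁ b≤c | inj₂ c≤a = sorted b≤c c≤a bca
    (mid-via (i≥j⇒i⊓j≡j b≤a) (i≥j⇒i⊔j≡i b≤a) (i≥j⇒i⊓j≡j c≤a) (i≤j⇒i⊔j≡j b≤c))
  ... | inj₂ b≤a | inj₂ c≤b | _ = sorted c≤b b≤a cba
    (mid-via (i≥j⇒i⊓j≡j b≤a) (i≥j⇒i⊔j≡i b≤a) (i≥j⇒i⊓j≡j (≤-trans c≤b b≤a)) (i≥j⇒i⊔j≡i c≤b))

  absDev : ℤ → ℤ → ℤ → ℤ → ℤ
  absDev t a b c = abs (a - t) + abs (b - t) + abs (c - t)

  absDev-perm : ∀ {a b c u m w} t → Perm3 a b c u m w → absDev t a b c ≡ absDev t u m w
  absDev-perm t p = +-perm3 (Perm3-map (λ x → abs (x - t)) p)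

  module _ {u m w : ℤ} (u≤m : u ≤ m) (m≤w : m ≤ w) where

    absDev-sorted : ∀ {t} → u ≤ t → t ≤ w → absDev t u m w ≡ (w - u) + abs (m - t)
    absDev-sorted {t} u≤t t≤w = begin-equality
      abs (u - t) + abs (m - t) + abs (w - t) ≡⟨ cong₂ (λ x y → x + abs (m - t) + y) (∣-∣-≤ u≤t) (abs-≥ t≤w) ⟩
      (t - u) + abs (m - t) + (w - t)         ≡⟨ rearrange t u w (abs (m - t)) ⟩
      (w - u) + abs (m - t)                   ∎
      where
      open ≤-Reasoning
      rearrange : ∀ t u w x → (t - u) + x + (w - t) ≡ (w - u) + x
      rearrange = solve-∀

    range≤absDev : ∀ t → w - u ≤ abs (u - t) + abs (w - t)
    range≤absDev t = subst (_≤ abs (u - t) + abs (w - t)) (telescope t u w) (+-mono-≤ (-i≤abs (u - t)) (i≤abs (w - t)))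
      where
      telescope : ∀ t u w → - (u - t) + (w - t) ≡ w - u
      telescope = solve-∀

    absDev-sorted-median : ∀ t → absDev m u m w + abs (m - t) ≤ absDev t u m w
    absDev-sorted-median t = begin
      absDev m u m w + abs (m - t)               ≡⟨ cong (_+ abs (m - t)) (absDev-sorted u≤m m≤w) ⟩
      (w - u) + abs (m - m) + abs (m - t)        ≡⟨ cong (λ x → (w - u) + abs x + abs (m - t)) (+-inverseʳ m) ⟩
      (w - u) + 0ℤ + abs (m - t)                 ≡⟨ cong (_+ abs (m - t)) (+-identityʳ (w - u)) ⟩
      (w - u) + abs (m - t)                      ≤⟨ +-monoˡ-≤ (abs (m - t)) (range≤absDev t) ⟩
      abs (u - t) + abs (w - t) + abs (m - t)    ≡⟨ swap₂₃ (abs (u - t)) (abs (w - t)) (abs (m - t)) ⟩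
      absDev t u m w                             ∎
      where
      open ≤-Reasoning
      swap₂₃ : ∀ x y z → x + y + z ≡ x + z + y
      swap₂₃ = solve-∀

    absDev-sorted-shift : ∀ {t} t′ → u ≤ t → t ≤ w → absDev t u m w ≤ absDev t′ u m w + abs (t - t′)
    absDev-sorted-shift {t} t′ u≤t t≤w = begin
      absDev t u m w                                                ≡⟨ absDev-sorted u≤t t≤w ⟩
      (w - u) + abs (m - t)                                         ≤⟨ +-mono-≤ (range≤absDev t′) m-t-bound ⟩
      (abs (u - t′) + abs (w - t′)) + (abs (m - t′) + abs (t - t′))
        ≡⟨ rearrange (abs (u - t′)) (abs (w - t′)) (abs (m - t′)) (abs (t - t′)) ⟩
      absDev t′ u m w + abs (t - t′)                                ∎
      where
      open ≤-Reasoning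
      m-t-bound : abs (m - t) ≤ abs (m - t′) + abs (t - t′)
      m-t-bound = subst (λ d → abs (m - t) ≤ abs (m - t′) + d) (abs-sym t′ t) (abs-triangle m t′ t)
      rearrange : ∀ x y z e → (x + y) + (z + e) ≡ x + z + y + e
      rearrange = solve-∀

  absDev-mid : ∀ a b c t → absDev (mid a b c) a b c + abs (mid a b c - t) ≤ absDev t a b c
  absDev-mid a b c t with sort3 a b c
  ... | sorted lo≤md md≤hi p refl = subst₂ (λ x y → x + abs (mid a b c - t) ≤ y)
    (sym (absDev-perm (mid a b c) p)) (sym (absDev-perm t p)) (absDev-sorted-median lo≤md md≤hi t)

  absDev-shift : ∀ {a b c t} t′ → AnyOf3 (_≤ t) a b c → AnyOf3 (t ≤_) a b c →
    absDev t a b c ≤ absDev t′ a b c + abs (t - t′)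
  absDev-shift {a} {b} {c} {t} t′ below above with sort3 a b c
  ... | sorted {lo} {md} {hi} lo≤md md≤hi p _ =
    subst₂ (λ x y → x ≤ y + abs (t - t′)) (sym (absDev-perm t p)) (sym (absDev-perm t′ p))
      (absDev-sorted-shift lo≤md md≤hi t′ lo≤t t≤hi)
    where
    lo≤hi = ≤-trans lo≤md md≤hi
    bounds : AllOf3 (λ x → lo ≤ x × x ≤ hi) a b c
    bounds = AllOf3-perm p ((≤-refl , lo≤hi) , (lo≤md , md≤hi) , (lo≤hi , ≤-refl))
    lo≤t : lo ≤ t
    lo≤t with _ , x≤t , lo≤x , _ ← AnyOf3-AllOf3 below bounds = ≤-trans lo≤x x≤t
    t≤hi : t ≤ hi
    t≤hi with _ , t≤x , _ , x≤hi ← AnyOf3-AllOf3 above bounds = ≤-trans t≤x x≤hi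

  mid-lower : ∀ a b c → TwoOf3 (_≤ mid a b c) a b c
  mid-lower a b c with sort3 a b c
  ... | sorted lo≤md _ p refl = TwoOf3-perm-lower p lo≤md ≤-refl

  mid-upper : ∀ a b c → TwoOf3 (mid a b c ≤_) a b c
  mid-upper a b c with sort3 a b c
  ... | sorted _ md≤hi p refl = TwoOf3-perm-upper p ≤-refl md≤hi

module Distance where

  open Medians
  open import Data.Nat as ℕ using (ℕ; zero; suc)
  import Data.Nat.Properties as ℕ
  open import Data.Nat.Tactic.RingSolver as ℕ-Solver using ()
  open import Data.Integer as ℤ using (ℤ; +_; -[1+_]; 0ℤ; 1ℤ; -1ℤ; _+_; _-_; -_; _*_; _<_; _≤_; ∣_∣; +≤+)
  open import Data.Integer.Properties
  open import Data.Integer.Tactic.RingSolver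
  open import Data.Product using (Σ; _×_; _,_)
  open import Data.Sum using (_⊎_; inj₁; inj₂)
  open import Relation.Binary.Definitions using (tri<; tri≈; tri>)
  open import Relation.Binary.PropositionalEquality

  diff-of-diffs : ∀ a b c d → (a - c) - (b - d) ≡ (a - b) - (c - d)
  diff-of-diffs = solve-∀

  twiceDist : Point → Point → ℕ
  twiceDist (x , y) (x′ , y′) = ∣ x - x′ ∣ ℕ.+ ∣ y - y′ ∣ ℕ.+ ∣ (x - y) - (x′ - y′) ∣

  totalDist : Point → Point → Point → Point → ℕ
  totalDist p q r c = twiceDist p c ℕ.+ twiceDist q c ℕ.+ twiceDist r c

  median : Point → Point → Point → Point
  median (x₁ , y₁) (x₂ , y₂) (x₃ , y₃) = mid x₁ x₂ x₃ , mid y₁ y₂ y₃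

  spread-double-twiceDist : ∀ x y cx cy → spread (x - cx) (y - cy) + spread (x - cx) (y - cy) ≡ + twiceDist (x , y) (cx , cy)
  spread-double-twiceDist x y cx cy =
    trans (spread-double (x - cx) (y - cy)) (cong (λ d → abs (x - cx) + abs (y - cy) + abs d) (diff-of-diffs x y cx cy))

  formula-double : ∀ p q r → formula p q r + formula p q r ≡ + totalDist p q r (median p q r)
  formula-double (x₁ , y₁) (x₂ , y₂) (x₃ , y₃) =
    trans (double-sum (spread (x₁ - xm) (y₁ - ym)) (spread (x₂ - xm) (y₂ - ym)) (spread (x₃ - xm) (y₃ - ym)))
      (cong₂ _+_ (cong₂ _+_ (spread-double-twiceDist x₁ y₁ xm ym) (spread-double-twiceDist x₂ y₂ xm ym))
        (spread-double-twiceDist x₃ y₃ xm ym))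
    where
    xm = mid x₁ x₂ x₃
    ym = mid y₁ y₂ y₃
    double-sum : ∀ a b c → (a + b + c) + (a + b + c) ≡ (a + a) + (b + b) + (c + c)
    double-sum = solve-∀

  +totalDist≡absDev : ∀ x₁ y₁ x₂ y₂ x₃ y₃ cx cy →
    + totalDist (x₁ , y₁) (x₂ , y₂) (x₃ , y₃) (cx , cy) ≡
    absDev cx x₁ x₂ x₃ + absDev cy y₁ y₂ y₃ + absDev (cx - cy) (x₁ - y₁) (x₂ - y₂) (x₃ - y₃)
  +totalDist≡absDev x₁ y₁ x₂ y₂ x₃ y₃ cx cy = transpose
    (abs (x₁ - cx)) (abs (y₁ - cy)) (abs ((x₁ - y₁) - (cx - cy)))
    (abs (x₂ - cx)) (abs (y₂ - cy)) (abs ((x₂ - y₂) - (cx - cy)))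
    (abs (x₃ - cx)) (abs (y₃ - cy)) (abs ((x₃ - y₃) - (cx - cy)))
    where
    transpose : ∀ a₁ b₁ c₁ a₂ b₂ c₂ a₃ b₃ c₃ →
      (a₁ + b₁ + c₁) + (a₂ + b₂ + c₂) + (a₃ + b₃ + c₃) ≡
      (a₁ + a₂ + a₃) + (b₁ + b₂ + b₃) + (c₁ + c₂ + c₃)
    transpose = solve-∀

  totalDist-median : ∀ p q r c → totalDist p q r (median p q r) ℕ.≤ totalDist p q r c
  totalDist-median (x₁ , y₁) (x₂ , y₂) (x₃ , y₃) (cx , cy) = drop‿+≤+ (begin
    + totalDist p q r (xm , ym)                  ≡⟨ +totalDist≡absDev x₁ y₁ x₂ y₂ x₃ y₃ xm ym ⟩
    Sx xm + Sy ym + Sz (xm - ym)                 ≤⟨ +-monoʳ-≤ (Sx xm + Sy ym) (absDev-shift (cx - cy) below above) ⟩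
    Sx xm + Sy ym + (Sz (cx - cy) + abs ((xm - ym) - (cx - cy)))
      ≤⟨ +-monoʳ-≤ (Sx xm + Sy ym) (+-monoʳ-≤ (Sz (cx - cy)) medians-split) ⟩
    Sx xm + Sy ym + (Sz (cx - cy) + (abs (xm - cx) + abs (ym - cy)))
      ≡⟨ rearrange (Sx xm) (Sy ym) (Sz (cx - cy)) (abs (xm - cx)) (abs (ym - cy)) ⟩
    (Sx xm + abs (xm - cx)) + (Sy ym + abs (ym - cy)) + Sz (cx - cy)
      ≤⟨ +-monoˡ-≤ (Sz (cx - cy)) (+-mono-≤ (absDev-mid x₁ x₂ x₃ cx) (absDev-mid y₁ y₂ y₃ cy)) ⟩
    Sx cx + Sy cy + Sz (cx - cy)                 ≡⟨ +totalDist≡absDev x₁ y₁ x₂ y₂ x₃ y₃ cx cy ⟨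
    + totalDist p q r (cx , cy)                  ∎)
    where
    open ≤-Reasoning
    p = (x₁ , y₁)
    q = (x₂ , y₂)
    r = (x₃ , y₃)
    xm = mid x₁ x₂ x₃
    ym = mid y₁ y₂ y₃
    Sx = λ t → absDev t x₁ x₂ x₃
    Sy = λ t → absDev t y₁ y₂ y₃
    Sz = λ t → absDev t (x₁ - y₁) (x₂ - y₂) (x₃ - y₃)
    -‿mono-≤ : ∀ {i j k l} → i ≤ j → l ≤ k → i - k ≤ j - l
    -‿mono-≤ i≤j l≤k = +-mono-≤ i≤j (neg-mono-≤ l≤k)
    below : AnyOf3 (_≤ xm - ym) (x₁ - y₁) (x₂ - y₂) (x₃ - y₃)
    below = TwoOf3-overlap _-_ -‿mono-≤ (mid-lower x₁ x₂ x₃) (mid-upper y₁ y₂ y₃)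
    above : AnyOf3 (xm - ym ≤_) (x₁ - y₁) (x₂ - y₂) (x₃ - y₃)
    above = TwoOf3-overlap _-_ -‿mono-≤ (mid-upper x₁ x₂ x₃) (mid-lower y₁ y₂ y₃)
    medians-split : abs ((xm - ym) - (cx - cy)) ≤ abs (xm - cx) + abs (ym - cy)
    medians-split = subst (λ d → abs d ≤ abs (xm - cx) + abs (ym - cy)) (diff-of-diffs xm ym cx cy)
      (+≤+ (∣i-j∣≤∣i∣+∣j∣ (xm - cx) (ym - cy)))
    rearrange : ∀ a b c d e → a + b + (c + (d + e)) ≡ (a + d) + (b + e) + c
    rearrange = solve-∀

  formula≡half-totalDist : ∀ p q r n → totalDist p q r (median p q r) ≡ 2 ℕ.* n → formula p q r ≡ + n
  formula≡half-totalDist p q r n total≡ = *-cancelˡ-≡ (+ 2) (formula p q r) (+ n) (begin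
    + 2 * formula p q r              ≡⟨ double (formula p q r) ⟩
    formula p q r + formula p q r    ≡⟨ formula-double p q r ⟩
    + totalDist p q r (median p q r) ≡⟨ cong +_ total≡ ⟩
    + (n ℕ.+ (n ℕ.+ 0))              ≡⟨ cong (λ k → + (n ℕ.+ k)) (ℕ.+-identityʳ n) ⟩
    + n + + n                        ≡⟨ double (+ n) ⟨
    + 2 * + n                        ∎)
    where
    open ≡-Reasoning
    double : ∀ i → + 2 * i ≡ i + i
    double = solve-∀

  twiceDist-self : ∀ u → twiceDist u u ≡ 0
  twiceDist-self (x , y) rewrite +-inverseʳ x | +-inverseʳ y | +-inverseʳ (x - y) = refl

  twiceDist-sym : ∀ u v → twiceDist u v ≡ twiceDist v u
  twiceDist-sym (x , y) (x′ , y′) =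
    cong₂ ℕ._+_ (cong₂ ℕ._+_ (∣i-j∣≡∣j-i∣ x x′) (∣i-j∣≡∣j-i∣ y y′))
                (∣i-j∣≡∣j-i∣ (x - y) (x′ - y′))

  ∣-∣-triangle : ∀ i j k → ∣ i - k ∣ ℕ.≤ ∣ i - j ∣ ℕ.+ ∣ j - k ∣
  ∣-∣-triangle i j k = drop‿+≤+ (abs-triangle i j k)

  twiceDist-triangle : ∀ u v w → twiceDist u w ℕ.≤ twiceDist u v ℕ.+ twiceDist v w
  twiceDist-triangle (x , y) (x′ , y′) (x″ , y″) = ℕ.≤-trans
    (ℕ.+-mono-≤ (ℕ.+-mono-≤ (∣-∣-triangle x x′ x″) (∣-∣-triangle y y′ y″))
                (∣-∣-triangle (x - y) (x′ - y′) (x″ - y″)))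
    (ℕ.≤-reflexive (transpose (∣ x - x′ ∣) (∣ x′ - x″ ∣) (∣ y - y′ ∣) (∣ y′ - y″ ∣) _ _))
    where
    transpose : ∀ a a′ b b′ c c′ →
      (a ℕ.+ a′) ℕ.+ (b ℕ.+ b′) ℕ.+ (c ℕ.+ c′) ≡ (a ℕ.+ b ℕ.+ c) ℕ.+ (a′ ℕ.+ b′ ℕ.+ c′)
    transpose = ℕ-Solver.solve-∀

  twiceDist-translate : ∀ x y {x′ y′} s s′ → x′ ≡ x + s → y′ ≡ y + s′ →
    twiceDist (x , y) (x′ , y′) ≡ ∣ s ∣ ℕ.+ ∣ s′ ∣ ℕ.+ ∣ s - s′ ∣
  twiceDist-translate x y s s′ refl refl = cong₂ ℕ._+_
    (cong₂ ℕ._+_ (∣negation∣ s (cancel x s)) (∣negation∣ s′ (cancel y s′)))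
    (∣negation∣ (s - s′) (regroup x y s s′))
    where
    ∣negation∣ : ∀ {e} s → e ≡ - s → ∣ e ∣ ≡ ∣ s ∣
    ∣negation∣ s refl = ∣-i∣≡∣i∣ s
    cancel : ∀ x s → x - (x + s) ≡ - s
    cancel = solve-∀
    regroup : ∀ x y s s′ → (x - y) - ((x + s) - (y + s′)) ≡ - (s - s′)
    regroup = solve-∀

  private
    unmoved : ∀ x → x ≡ x + 0ℤ
    unmoved x = sym (+-identityʳ x)

  twiceDist-adj : ∀ {u w} → Adj u w → twiceDist u w ≡ 2
  twiceDist-adj (e+x x y)  = twiceDist-translate x y 1ℤ 0ℤ refl (unmoved y)
  twiceDist-adj (e-x x y)  = twiceDist-translate x y -1ℤ 0ℤ refl (unmoved y)
  twiceDist-adj (e+y x y)  = twiceDist-translate x y 0ℤ 1ℤ (unmoved x) refl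
  twiceDist-adj (e-y x y)  = twiceDist-translate x y 0ℤ -1ℤ (unmoved x) refl
  twiceDist-adj (e+xy x y) = twiceDist-translate x y 1ℤ 1ℤ refl refl
  twiceDist-adj (e-xy x y) = twiceDist-translate x y -1ℤ -1ℤ refl refl

  data Aligned : ℤ → ℤ → Set where
    still : ∀ {i} → Aligned 0ℤ i
    up    : ∀ {i} → 0ℤ < i → Aligned 1ℤ i
    down  : ∀ {i} → i < 0ℤ → Aligned -1ℤ i

  ∣-∣-aligned : ∀ {s i} → Aligned s i → ∣ i - s ∣ ℕ.+ ∣ s ∣ ≡ ∣ i ∣
  ∣-∣-aligned {i = i} still = trans (ℕ.+-identityʳ _) (cong ∣_∣ (+-identityʳ i))
  ∣-∣-aligned {i = + suc n} (up _) = ℕ.+-comm n 1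
  ∣-∣-aligned {i = -[1+ zero ]} (down _) = refl
  ∣-∣-aligned {i = -[1+ suc n ]} (down _) = ℕ.+-comm (suc n) 1
  ∣-∣-aligned {i = + zero} (up (ℤ.+<+ ()))
  ∣-∣-aligned {i = + n} (down (ℤ.+<+ ()))

  twiceDist-toward : ∀ tx ty ux uy {wx wy s s′} → wx ≡ ux + s → wy ≡ uy + s′ →
    Aligned s (tx - ux) → Aligned s′ (ty - uy) → Aligned (s - s′) ((tx - ux) - (ty - uy)) →
    twiceDist (tx , ty) (wx , wy) ℕ.+ (∣ s ∣ ℕ.+ ∣ s′ ∣ ℕ.+ ∣ s - s′ ∣) ≡ twiceDist (tx , ty) (ux , uy)
  twiceDist-toward tx ty ux uy {s = s} {s′} refl refl as as′ as″ = begin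
    ∣ tx - (ux + s) ∣ ℕ.+ ∣ ty - (uy + s′) ∣ ℕ.+ ∣ (tx - ty) - ((ux + s) - (uy + s′)) ∣
      ℕ.+ (∣ s ∣ ℕ.+ ∣ s′ ∣ ℕ.+ ∣ s - s′ ∣)
      ≡⟨ cong₃ (λ a b c → ∣ a ∣ ℕ.+ ∣ b ∣ ℕ.+ ∣ c ∣ ℕ.+ (∣ s ∣ ℕ.+ ∣ s′ ∣ ℕ.+ ∣ s - s′ ∣))
           (shift tx ux s) (shift ty uy s′) (shift-diff tx ty ux uy s s′) ⟩
    ∣ a - s ∣ ℕ.+ ∣ b - s′ ∣ ℕ.+ ∣ (a - b) - (s - s′) ∣ ℕ.+ (∣ s ∣ ℕ.+ ∣ s′ ∣ ℕ.+ ∣ s - s′ ∣)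
      ≡⟨ transpose (∣ a - s ∣) (∣ b - s′ ∣) (∣ (a - b) - (s - s′) ∣) (∣ s ∣) (∣ s′ ∣) _ ⟩
    (∣ a - s ∣ ℕ.+ ∣ s ∣) ℕ.+ (∣ b - s′ ∣ ℕ.+ ∣ s′ ∣) ℕ.+ (∣ (a - b) - (s - s′) ∣ ℕ.+ ∣ s - s′ ∣)
      ≡⟨ cong₃ (λ i j k → i ℕ.+ j ℕ.+ k) (∣-∣-aligned as) (∣-∣-aligned as′) (∣-∣-aligned as″) ⟩
    ∣ a ∣ ℕ.+ ∣ b ∣ ℕ.+ ∣ a - b ∣
      ≡⟨ cong (λ c → ∣ a ∣ ℕ.+ ∣ b ∣ ℕ.+ ∣ c ∣) (diff-of-diffs tx ty ux uy) ⟩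
    twiceDist (tx , ty) (ux , uy) ∎
    where
    open ≡-Reasoning
    a = tx - ux
    b = ty - uy
    cong₃ : ∀ {A : Set} (f : A → A → A → ℕ) {x x′ y y′ z z′} →
      x ≡ x′ → y ≡ y′ → z ≡ z′ → f x y z ≡ f x′ y′ z′
    cong₃ f refl refl refl = refl
    shift : ∀ t u s → t - (u + s) ≡ (t - u) - s
    shift = solve-∀
    shift-diff : ∀ tx ty ux uy s s′ → (tx - ty) - ((ux + s) - (uy + s′)) ≡ ((tx - ux) - (ty - uy)) - (s - s′)
    shift-diff = solve-∀
    transpose : ∀ a b c a′ b′ c′ →
      a ℕ.+ b ℕ.+ c ℕ.+ (a′ ℕ.+ b′ ℕ.+ c′) ≡ (a ℕ.+ a′) ℕ.+ (b ℕ.+ b′) ℕ.+ (c ℕ.+ c′)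
    transpose = ℕ-Solver.solve-∀

  private
    pos-minus-nonpos : ∀ {i j} → 0ℤ < i → j ≤ 0ℤ → 0ℤ < i - j
    pos-minus-nonpos 0<i j≤0 = +-mono-<-≤ 0<i (neg-mono-≤ j≤0)

    neg-minus-nonneg : ∀ {i j} → i < 0ℤ → 0ℤ ≤ j → i - j < 0ℤ
    neg-minus-nonneg i<0 0≤j = +-mono-<-≤ i<0 (neg-mono-≤ 0≤j)

    nonpos-minus-pos : ∀ {i j} → i ≤ 0ℤ → 0ℤ < j → i - j < 0ℤ
    nonpos-minus-pos i≤0 0<j = +-mono-≤-< i≤0 (neg-mono-< 0<j)

    nonneg-minus-neg : ∀ {i j} → 0ℤ ≤ i → j < 0ℤ → 0ℤ < i - j
    nonneg-minus-neg 0≤i j<0 = +-mono-≤-< 0≤i (neg-mono-< j<0)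

  descend : ∀ t u → t ≡ u ⊎ Σ Point λ w → Adj u w × twiceDist t w ℕ.+ 2 ≡ twiceDist t u
  descend (tx , ty) (ux , uy) with <-cmp (tx - ux) 0ℤ | <-cmp (ty - uy) 0ℤ
  ... | tri> _ _ a>0 | tri> _ _ b>0 = inj₂ (_ , e+xy ux uy ,
    twiceDist-toward tx ty ux uy refl refl (up a>0) (up b>0) still)
  ... | tri< a<0 _ _ | tri< b<0 _ _ = inj₂ (_ , e-xy ux uy ,
    twiceDist-toward tx ty ux uy refl refl (down a<0) (down b<0) still)
  ... | tri> _ _ a>0 | tri< b<0 _ _ = inj₂ (_ , e+x ux uy ,
    twiceDist-toward tx ty ux uy refl (unmoved uy) (up a>0) still (up (pos-minus-nonpos a>0 (<⇒≤ b<0))))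
  ... | tri> _ _ a>0 | tri≈ _ b≡0 _ = inj₂ (_ , e+x ux uy ,
    twiceDist-toward tx ty ux uy refl (unmoved uy) (up a>0) still (up (pos-minus-nonpos a>0 (≤-reflexive b≡0))))
  ... | tri< a<0 _ _ | tri> _ _ b>0 = inj₂ (_ , e-x ux uy ,
    twiceDist-toward tx ty ux uy refl (unmoved uy) (down a<0) still (down (neg-minus-nonneg a<0 (<⇒≤ b>0))))
  ... | tri< a<0 _ _ | tri≈ _ b≡0 _ = inj₂ (_ , e-x ux uy ,
    twiceDist-toward tx ty ux uy refl (unmoved uy) (down a<0) still (down (neg-minus-nonneg a<0 (≤-reflexive (sym b≡0)))))
  ... | tri≈ _ a≡0 _ | tri> _ _ b>0 = inj₂ (_ , e+y ux uy ,
    twiceDist-toward tx ty ux uy (unmoved ux) refl still (up b>0) (down (nonpos-minus-pos (≤-reflexive a≡0) b>0)))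
  ... | tri≈ _ a≡0 _ | tri< b<0 _ _ = inj₂ (_ , e-y ux uy ,
    twiceDist-toward tx ty ux uy (unmoved ux) refl still (down b<0) (up (nonneg-minus-neg (≤-reflexive (sym a≡0)) b<0)))
  ... | tri≈ _ a≡0 _ | tri≈ _ b≡0 _ = inj₁ (cong₂ _,_ (i-j≡0⇒i≡j tx ux a≡0) (i-j≡0⇒i≡j ty uy b≡0))

module Trees where

  open Distance
  open import Data.Nat using (ℕ; suc; _+_; _*_; _≤_; _<_; z≤n; s≤s)
  open import Data.Nat.Properties
  open import Data.Nat.Tactic.RingSolver using (solve-∀)
  open import Data.Nat.Induction using (<-wellFounded)
  open import Induction.WellFounded using (Acc; acc)
  import Data.Integer as ℤ
  open import Data.Product using (Σ; _×_; _,_; proj₁; proj₂)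
  open import Data.Product.Properties using (≡-dec)
  open import Data.Sum using (_⊎_; inj₁; inj₂)
  open import Data.List using (List; []; _∷_; _++_; length)
  open import Data.List.Properties using (length-++; length-removeAt′)
  open import Data.List.Relation.Unary.All as All using (All; []; _∷_)
  import Data.List.Relation.Unary.All.Properties as All
  open import Data.List.Relation.Unary.AllPairs using ([]; _∷_)
  open import Data.List.Relation.Unary.Any using (here; there; index; _─_)
  open import Data.List.Relation.Unary.Unique.Propositional using (Unique)
  import Data.List.Relation.Unary.Unique.Propositional.Properties as Unique
  open import Data.List.Membership.Propositional using (_∈_; _∉_)
  open import Data.List.Membership.Propositional.Properties using (∈-++⁺ˡ; ∈-++⁺ʳ; ∈-++⁻)
  open import Data.List.Relation.Binary.Subset.Propositional using (_⊆_)
  open import Data.Empty using (⊥-elim)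
  open import Relation.Nullary using (¬_; yes; no)
  open import Relation.Binary.PropositionalEquality

  _≟ₚ_ : (u v : Point) → Relation.Nullary.Dec (u ≡ v)
  _≟ₚ_ = ≡-dec ℤ._≟_ ℤ._≟_

  open import Data.List.Membership.DecPropositional _≟ₚ_ using (_∈?_)

  ∈-─ : ∀ {A : Set} {x z : A} {ys} (x∈ys : x ∈ ys) → z ∈ ys → z ≢ x → z ∈ (ys ─ x∈ys)
  ∈-─ (here refl) (here refl) z≢x = ⊥-elim (z≢x refl)
  ∈-─ (here _)    (there z∈)  _   = z∈
  ∈-─ (there _)   (here z≡y)  _   = here z≡y
  ∈-─ (there x∈)  (there z∈)  z≢x = there (∈-─ x∈ z∈ z≢x)

  Unique-⊆⇒length-≤ : ∀ {A : Set} {xs ys : List A} → Unique xs → xs ⊆ ys → length xs ≤ length ys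
  Unique-⊆⇒length-≤ {xs = []} _ _ = z≤n
  Unique-⊆⇒length-≤ {xs = x ∷ xs} {ys} (x∉xs ∷ unique) xs⊆ys =
    subst (suc (length xs) ≤_) (sym (length-removeAt′ ys (index x∈ys)))
      (s≤s (Unique-⊆⇒length-≤ unique xs⊆ys─x))
    where
    x∈ys = xs⊆ys (here refl)
    xs⊆ys─x : xs ⊆ (ys ─ x∈ys)
    xs⊆ys─x z∈xs = ∈-─ x∈ys (xs⊆ys (there z∈xs)) (λ z≡x → All.lookup x∉xs z∈xs (sym z≡x))

  Unique-++⁻ˡ : ∀ {A : Set} (xs : List A) {ys} → Unique (xs ++ ys) → Unique xs
  Unique-++⁻ˡ [] _ = []
  Unique-++⁻ˡ (x ∷ xs) (x∉ ∷ unique) = All.++⁻ˡ xs x∉ ∷ Unique-++⁻ˡ xs unique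

  Unique-++⁻ʳ : ∀ {A : Set} (xs : List A) {ys} → Unique (xs ++ ys) → Unique ys
  Unique-++⁻ʳ [] unique = unique
  Unique-++⁻ʳ (x ∷ xs) (_ ∷ unique) = Unique-++⁻ʳ xs unique

  ∷-⊆ : ∀ {A : Set} {x : A} {xs ys} → x ∈ ys → xs ⊆ ys → x ∷ xs ⊆ ys
  ∷-⊆ x∈ys _     (here refl) = x∈ys
  ∷-⊆ _    xs⊆ys (there z∈)  = xs⊆ys z∈

  ∉⇒All≢ : ∀ {A : Set} {x : A} {xs} → x ∉ xs → All (x ≢_) xs
  ∉⇒All≢ x∉xs = All.tabulate λ z∈xs x≡z → x∉xs (subst (_∈ _) (sym x≡z) z∈xs)

  Near : Point → Point → Set
  Near u w = Adj u w ⊎ Adj w u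

  twiceDist-near : ∀ {u w} → Near u w → twiceDist u w ≡ 2
  twiceDist-near (inj₁ u~w) = twiceDist-adj u~w
  twiceDist-near {u} {w} (inj₂ w~u) = trans (twiceDist-sym u w) (twiceDist-adj w~u)

  data Chain : Point → Point → List Point → Set where
    stay : ∀ u → Chain u u (u ∷ [])
    hop  : ∀ {u w v l} → Near u w → Chain w v l → Chain u v (u ∷ l)

  chain-start : ∀ {u v l} → Chain u v l → u ∈ l
  chain-start (stay u)  = here refl
  chain-start (hop _ _) = here refl

  chain-length : ∀ {u v l} → Chain u v l → twiceDist u v + 2 ≤ 2 * length l
  chain-length (stay u) = ≤-reflexive (cong (_+ 2) (twiceDist-self u))
  chain-length {u} {v} (hop {w = w} {l = l} u~w chain) = begin
    twiceDist u v + 2                 ≤⟨ +-monoˡ-≤ 2 (twiceDist-triangle u w v) ⟩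
    twiceDist u w + twiceDist w v + 2 ≡⟨ cong (λ d → d + twiceDist w v + 2) (twiceDist-near u~w) ⟩
    2 + (twiceDist w v + 2)           ≤⟨ +-monoʳ-≤ 2 (chain-length chain) ⟩
    2 + 2 * length l                  ≡⟨ *-suc 2 (length l) ⟨
    2 * suc (length l)                ∎
    where open ≤-Reasoning

  record ChainSplit (u v c : Point) (l : List Point) : Set where
    constructor split
    field
      before after : List Point
      split-at-c   : l ≡ before ++ c ∷ after
      to-c         : Chain u c (before ++ c ∷ [])
      from-c       : Chain c v (c ∷ after)

  chain-split : ∀ {u v l c} → Chain u v l → c ∈ l → ChainSplit u v c l
  chain-split (stay u) (here refl) = split [] [] refl (stay u) (stay u)
  chain-split (hop u~w chain) (here refl) = split [] _ refl (stay _) (hop u~w chain)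
  chain-split {u = u} (hop u~w chain) (there c∈l) with chain-split chain c∈l
  ... | split l₁ l₂ refl to-c from-c = split (u ∷ l₁) l₂ refl (hop u~w to-c) from-c

  chain-simplify : ∀ {u v l} → Chain u v l → Σ (List Point) λ l′ → Chain u v l′ × Unique l′ × l′ ⊆ l
  chain-simplify (stay u) = _ , stay u , [] ∷ [] , λ z∈ → z∈
  chain-simplify {u} (hop u~w chain) with chain-simplify chain
  ... | l′ , chain′ , unique , l′⊆l with u ∈? l′
  ...   | no u∉l′ =
    u ∷ l′ , hop u~w chain′ , ∉⇒All≢ u∉l′ ∷ unique , ∷-⊆ (here refl) (λ z∈ → there (l′⊆l z∈))
  ...   | yes u∈l′ with chain-split chain′ u∈l′
  ...     | split l₁ l₂ refl _ loop-free =
    u ∷ l₂ , loop-free , Unique-++⁻ʳ l₁ unique , λ z∈ → there (l′⊆l (∈-++⁺ʳ l₁ z∈))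

  record FirstHit (S : List Point) (r : Point) (l : List Point) : Set where
    constructor first-hit
    field
      prefix       : List Point
      hit          : Point
      suffix       : List Point
      split-at-hit : l ≡ prefix ++ hit ∷ suffix
      hit∈S        : hit ∈ S
      prefix∉S     : All (_∉ S) prefix
      to-hit       : Chain r hit (prefix ++ hit ∷ [])

  chain-first-hit : ∀ (S : List Point) {r p l} → Chain r p l → p ∈ S → FirstHit S r l
  chain-first-hit S (stay u) u∈S = first-hit [] u [] refl u∈S [] (stay u)
  chain-first-hit S {r} (hop r~w chain) p∈S with r ∈? S
  ... | yes r∈S = first-hit [] r _ refl r∈S [] (stay r)
  ... | no r∉S with chain-first-hit S chain p∈S
  ...   | first-hit A c B refl c∈S A∉S to-c = first-hit (r ∷ A) c B refl c∈S (r∉S ∷ A∉S) (hop r~w to-c)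

  edge-step : ∀ {V E} → IsTree V E → ∀ {u w} → (u , w) ∈ E ⊎ (w , u) ∈ E → Near u w × w ∈ V
  edge-step T (inj₁ uw∈E) = inj₁ (All.lookup (IsTree.edgesAdj T) uw∈E) , proj₂ (All.lookup (IsTree.edgesInV T) uw∈E)
  edge-step T (inj₂ wu∈E) = inj₂ (All.lookup (IsTree.edgesAdj T) wu∈E) , proj₁ (All.lookup (IsTree.edgesInV T) wu∈E)

  walk⇒chain : ∀ {V E} → IsTree V E → ∀ {u v} → Walk E u v → u ∈ V → Σ (List Point) λ l → Chain u v l × l ⊆ V
  walk⇒chain T here u∈V = _ , stay _ , ∷-⊆ u∈V (λ ())
  walk⇒chain T (step e walk) u∈V with edge-step T e
  ... | u~w , w∈V with walk⇒chain T walk w∈V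
  ...   | l , chain , l⊆V = _ , hop u~w chain , ∷-⊆ u∈V l⊆V

  record SimpleChain (V : List Point) (u v : Point) : Set where
    field
      vertices : List Point
      chain    : Chain u v vertices
      unique   : Unique vertices
      inside   : vertices ⊆ V

  simple-chain : ∀ {V E} → IsTree V E → ∀ {u v} → u ∈ V → v ∈ V → SimpleChain V u v
  simple-chain T u∈V v∈V with walk⇒chain T (IsTree.connected T u∈V v∈V) u∈V
  ... | l , chain , l⊆V with chain-simplify chain
  ...   | l′ , chain′ , unique , l′⊆l = record
    { vertices = l′ ; chain = chain′ ; unique = unique ; inside = λ z∈ → l⊆V (l′⊆l z∈) }

  length-tripod : ∀ {A : Set} (l₁ l₂ l₃ : List A) c →
    length (l₁ ++ c ∷ []) + length (c ∷ l₂) + length (l₃ ++ c ∷ []) ≡ length ((l₁ ++ c ∷ l₂) ++ l₃) + 2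
  length-tripod l₁ l₂ l₃ c
    rewrite length-++ l₁ {c ∷ []} | length-++ l₃ {c ∷ []} | length-++ (l₁ ++ c ∷ l₂) {l₃} | length-++ l₁ {c ∷ l₂}
    = arith (length l₁) (length l₂) (length l₃)
    where
    arith : ∀ a b c → a + 1 + suc b + (c + 1) ≡ a + suc b + c + 2
    arith = solve-∀

  tripod-bound : ∀ {p q r c l₁ l₂ l₃} n → Chain p c l₁ → Chain c q l₂ → Chain r c l₃ →
    length l₁ + length l₂ + length l₃ ≤ n + 3 → twiceDist p c + twiceDist c q + twiceDist r c ≤ 2 * n
  tripod-bound {p} {q} {r} {c} {l₁} {l₂} {l₃} n chain₁ chain₂ chain₃ count = +-cancelʳ-≤ 6 _ _ (begin
    twiceDist p c + twiceDist c q + twiceDist r c + 6       ≡⟨ spread-six (twiceDist p c) (twiceDist c q) (twiceDist r c) ⟩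
    (twiceDist p c + 2) + (twiceDist c q + 2) + (twiceDist r c + 2)
      ≤⟨ +-mono-≤ (+-mono-≤ (chain-length chain₁) (chain-length chain₂)) (chain-length chain₃) ⟩
    2 * length l₁ + 2 * length l₂ + 2 * length l₃           ≡⟨ distrib (length l₁) (length l₂) (length l₃) ⟩
    2 * (length l₁ + length l₂ + length l₃)                 ≤⟨ *-monoʳ-≤ 2 count ⟩
    2 * (n + 3)                                             ≡⟨ *-distribˡ-+ 2 n 3 ⟩
    2 * n + 6                                               ∎)
    where
    open ≤-Reasoning
    spread-six : ∀ a b c → a + b + c + 6 ≡ (a + 2) + (b + 2) + (c + 2)
    spread-six = solve-∀
    distrib : ∀ a b c → 2 * a + 2 * b + 2 * c ≡ 2 * (a + b + c)
    distrib = solve-∀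

  steiner-bound : ∀ {p q r} (T : TreeContaining p q r) → Σ Point λ c → totalDist p q r c ≤ 2 * size T
  steiner-bound {p} {q} {r} T = hit , (begin
    totalDist p q r hit
      ≡⟨ cong (λ d → twiceDist p hit + d + twiceDist r hit) (twiceDist-sym q hit) ⟩
    twiceDist p hit + twiceDist hit q + twiceDist r hit   ≤⟨ tripod-bound (length edges) to-c from-c to-hit count ⟩
    2 * length edges                                      ∎)
    where
    open ≤-Reasoning
    open TreeContaining T
    open IsTree isTree
    module PQ = SimpleChain (simple-chain isTree p∈ q∈)
    module RP = SimpleChain (simple-chain isTree r∈ p∈)
    open FirstHit (chain-first-hit PQ.vertices RP.chain (chain-start PQ.chain))
    open ChainSplit (chain-split PQ.chain hit∈S)
    disjoint-unique : Unique (PQ.vertices ++ prefix)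
    disjoint-unique = Unique.++⁺ PQ.unique (Unique-++⁻ˡ prefix (subst Unique split-at-hit RP.unique))
      λ (z∈PQ , z∈prefix) → All.lookup prefix∉S z∈prefix z∈PQ
    in-tree : PQ.vertices ++ prefix ⊆ verts
    in-tree z∈ with ∈-++⁻ PQ.vertices z∈
    ... | inj₁ z∈PQ = PQ.inside z∈PQ
    ... | inj₂ z∈prefix = RP.inside (subst (_ ∈_) (sym split-at-hit) (∈-++⁺ˡ z∈prefix))
    count : length (before ++ hit ∷ []) + length (hit ∷ after) + length (prefix ++ hit ∷ []) ≤ length edges + 3
    count = begin
      length (before ++ hit ∷ []) + length (hit ∷ after) + length (prefix ++ hit ∷ [])
        ≡⟨ trans (length-tripod before after prefix hit) (cong (λ l → length (l ++ prefix) + 2) (sym split-at-c)) ⟩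
      length (PQ.vertices ++ prefix) + 2  ≤⟨ +-monoˡ-≤ 2 (Unique-⊆⇒length-≤ disjoint-unique in-tree) ⟩
      length verts + 2                    ≡⟨ cong (_+ 2) (sym edgeCount) ⟩
      suc (length edges) + 2              ≡⟨ +-suc (length edges) 2 ⟨
      length edges + 3                    ∎

  walk-weaken : ∀ {E a b} e → Walk E a b → Walk (e ∷ E) a b
  walk-weaken e here = here
  walk-weaken e (step (inj₁ m) w) = step (inj₁ (there m)) (walk-weaken e w)
  walk-weaken e (step (inj₂ m) w) = step (inj₂ (there m)) (walk-weaken e w)

  walk-++ : ∀ {E a b c} → Walk E a b → Walk E b c → Walk E a c
  walk-++ here w′ = w′
  walk-++ (step m w) w′ = step m (walk-++ w w′)

  singleton-tree : ∀ c → IsTree (c ∷ []) []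
  singleton-tree c = record
    { vertsUnique = [] ∷ []
    ; edgesUnique = []
    ; edgesAdj    = []
    ; edgesInV    = []
    ; connected   = λ { (here refl) (here refl) → here }
    ; edgeCount   = refl
    }

  add-leaf : ∀ {V E u w} → IsTree V E → u ∈ V → Adj u w → w ∉ V → IsTree (w ∷ V) ((u , w) ∷ E)
  add-leaf {V} {E} {u} {w} T u∈V u~w w∉V = record
    { vertsUnique = ∉⇒All≢ w∉V ∷ vertsUnique
    ; edgesUnique = All.map new-edge edgesInV ∷ edgesUnique
    ; edgesAdj    = u~w ∷ edgesAdj
    ; edgesInV    = (there u∈V , here refl) ∷ All.map (λ (a∈ , b∈) → there a∈ , there b∈) edgesInV
    ; connected   = connected′
    ; edgeCount   = cong suc edgeCount
    }
    where
    open IsTree T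
    new-edge : ∀ {f : Edge} → proj₁ f ∈ V × proj₂ f ∈ V → ¬ SameEdge (u , w) f
    new-edge (_ , f₂∈V) (inj₁ refl) = w∉V f₂∈V
    new-edge (f₁∈V , _) (inj₂ refl) = w∉V f₁∈V
    connected′ : ∀ {a b} → a ∈ w ∷ V → b ∈ w ∷ V → Walk ((u , w) ∷ E) a b
    connected′ (here refl) (here refl) = here
    connected′ (here refl) (there b∈V) = step (inj₂ (here refl)) (walk-weaken _ (connected u∈V b∈V))
    connected′ (there a∈V) (here refl) = walk-++ (walk-weaken _ (connected a∈V u∈V)) (step (inj₁ (here refl)) here)
    connected′ (there a∈V) (there b∈V) = walk-weaken _ (connected a∈V b∈V)

  record Growth (V : List Point) (E : List Edge) (t : Point) (cost : ℕ) : Set where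
    constructor growth
    field
      {verts′} : List Point
      {edges′} : List Edge
      isTree′  : IsTree verts′ edges′
      reaches  : t ∈ verts′
      keeps    : V ⊆ verts′
      bounded  : 2 * length edges′ ≤ 2 * length E + cost

  grow-toward : ∀ {V E u w} → IsTree V E → u ∈ V → Adj u w → Growth V E w 2
  grow-toward {V} {w = w} T u∈V u~w with w ∈? V
  ... | yes w∈V = growth T w∈V (λ z∈ → z∈) (m≤m+n _ 2)
  ... | no w∉V = growth (add-leaf T u∈V u~w w∉V) (here refl) there (≤-reflexive (trans (*-suc 2 _) (+-comm 2 _)))

  Growth-∘ : ∀ {V E w t k k′} (g : Growth V E w k) →
    Growth (Growth.verts′ g) (Growth.edges′ g) t k′ → Growth V E t (k + k′)
  Growth-∘ {E = E} {k = k} {k′} (growth _ _ keeps bounded) (growth T t∈ keeps′ bounded′) =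
    growth T t∈ (λ z∈ → keeps′ (keeps z∈))
      (≤-trans bounded′ (≤-trans (+-monoˡ-≤ k′ bounded) (≤-reflexive (+-assoc (2 * length E) k k′))))

  approach : ∀ t {V E u} → IsTree V E → u ∈ V → Acc _<_ (twiceDist t u) → Growth V E t (twiceDist t u)
  approach t {V} {E} {u} T u∈V (acc rec) with descend t u
  ... | inj₁ refl = growth T u∈V (λ z∈ → z∈) (m≤m+n _ _)
  ... | inj₂ (w , u~w , closer) = subst (Growth V E t) (trans (+-comm 2 _) closer)
    (Growth-∘ first (approach t (Growth.isTree′ first) (Growth.reaches first) (rec w-closer)))
    where
    first = grow-toward T u∈V u~w
    w-closer : twiceDist t w < twiceDist t u
    w-closer = <-≤-trans (m<m+n _ (s≤s z≤n)) (≤-reflexive closer)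

  tree-through : ∀ p q r c → Σ (TreeContaining p q r) λ T → 2 * size T ≤ totalDist p q r c
  tree-through p q r c =
    record { isTree = G₃.isTree′
           ; p∈ = G₃.keeps (G₂.keeps G₁.reaches) ; q∈ = G₃.keeps G₂.reaches ; r∈ = G₃.reaches } ,
    ≤-trans G₃.bounded (+-monoˡ-≤ (twiceDist r c) (≤-trans G₂.bounded (+-monoˡ-≤ (twiceDist q c) G₁.bounded)))
    where
    toward : ∀ t {V E} → IsTree V E → c ∈ V → Growth V E t (twiceDist t c)
    toward t T c∈V = approach t T c∈V (<-wellFounded _)
    module G₁ = Growth (toward p (singleton-tree c) (here refl))
    module G₂ = Growth (toward q G₁.isTree′ (G₁.keeps (here refl)))
    module G₃ = Growth (toward r G₂.isTree′ (G₂.keeps (G₁.keeps (here refl))))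

open Distance
open Trees
open import Data.Nat using (_*_; _≤_)
open import Data.Nat.Properties using (≤-trans; ≤-reflexive; ≤-antisym; *-cancelˡ-≤)
open import Data.Product using (_,_; proj₁; proj₂)
open import Relation.Binary.PropositionalEquality using (refl; sym)

-- The distinctness hypotheses are unused: the formula holds for coincident points too.
theorem22 : (v₁ v₂ v₃ : Point) → v₁ ≢ v₂ → v₁ ≢ v₃ → v₂ ≢ v₃ →
    Σ ℕ (λ d → IsTristance v₁ v₂ v₃ d × (+ d ≡ formula v₁ v₂ v₃))
theorem22 v₁ v₂ v₃ _ _ _ = size T , ((T , refl) , minimal) , sym (formula≡half-totalDist v₁ v₂ v₃ (size T) exact)
  where
  m = median v₁ v₂ v₃
  T = proj₁ (tree-through v₁ v₂ v₃ m)
  below-every-tree : (t : TreeContaining v₁ v₂ v₃) → totalDist v₁ v₂ v₃ m ≤ 2 * size t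
  below-every-tree t = let c , bound = steiner-bound t in ≤-trans (totalDist-median v₁ v₂ v₃ c) bound
  exact : totalDist v₁ v₂ v₃ m ≡ 2 * size T
  exact = ≤-antisym (below-every-tree T) (proj₂ (tree-through v₁ v₂ v₃ m))
  minimal : (t : TreeContaining v₁ v₂ v₃) → size T ≤ size t
  minimal t = *-cancelˡ-≤ 2 (≤-trans (≤-reflexive (sym exact)) (below-every-tree t))
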